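{- Let $\rho$ be a pattern of length $k \geqslant 1$ which either contains exactly one entry equal to $0$, or contains exactly two entries equal to $0$ and begins with $0,0$ (i.e. $\rho_1=\rho_2=0$). Let $\sigma$ be an inversion sequence which contains $\rho$, and let $\tau$ be a child of $\sigma$ in the generating tree growing on the left. Then $\tau$ contains $\rho$.
   Context: For $n\geqslant 0$, an inversion sequence of size $n$ is a sequence $\sigma=(\sigma_1,\dots,\sigma_n)$ of integers with $\sigma_i\in\{0,\dots,i-1\}$ for all $i$. A pattern is a finite nonempty sequence of nonnegative integers whose set of values is an interval of integers starting at $0$. An inversion sequence $\sigma$ contains a pattern $\rho$ of length $k$ if there are indices $q_1<\dots<q_k$ such that $(\sigma_{q_1},\dots,\sigma_{q_k})$ is order-isomorphic to $\rho$ (i.e. $\sigma_{q_i}<\sigma_{q_j}$ iff $\rho_i<\rho_j$ and $\sigma_{q_i}=\sigma_{q_j}$ iff $\rho_i=\rho_j$); otherwise $\sigma$ avoids $\rho$. Let $\mathbf{Zeros}(\sigma)=\{i : \sigma_i=0\}$ and $\chi$ the indicator of a statement. The children of $\sigma$ (of size $n$) in the generating tree growing on the left are the sequences $\mathbf{child}(\sigma,Z)=0\cdot(\sigma_i+\chi(\sigma_i>0)+\chi(i\in Z))_{i\in[1,n]}$ for $Z\subseteq \mathbf{Zeros}(\sigma)$, where $\cdot$ denotes concatenation (i.e. add $1$ to every positive entry, add $1$ to the zeros at positions in $Z$, then prepend a $0$). -}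

module Defs where

open import Data.Nat using (ℕ; zero; suc; _+_; _<_; _≤_)
open import Data.Fin using (Fin; toℕ)
import Data.Fin as F
open import Data.Vec using (Vec; _∷_; lookup; tabulate)
open import Data.Bool using (Bool; true; false)
open import Data.Product using (Σ; _×_; ∃)
open import Relation.Binary.PropositionalEquality using (_≡_)
open import Relation.Nullary using (¬_)
open import Data.Sum using (_⊎_)
open import Data.Unit using (⊤)
open import Data.Empty using (⊥)
open import Data.Fin.Subset using (Subset; _∈_)

-- An inversion sequence of size n: σ_i ∈ {0,…,i-1} for 1-based i,
-- i.e. with 0-based index i : Fin n, lookup σ i ≤ toℕ i.
IsInversionSequence : {n : ℕ} → Vec ℕ n → Set
IsInversionSequence {n} σ = (i : Fin n) → lookup σ i ≤ toℕ i

IsPattern : {k : ℕ} → Vec ℕ k → Set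
IsPattern {k} ρ =
  (0 < k) × ∃ λ m → ((i : Fin k) → lookup ρ i ≤ m)
                  × ((v : ℕ) → v ≤ m → ∃ λ (i : Fin k) → lookup ρ i ≡ v)

Contains : {n k : ℕ} → Vec ℕ n → Vec ℕ k → Set
Contains {n} {k} σ ρ =
  ∃ λ (q : Fin k → Fin n) →
    ((i j : Fin k) → i F.< j → q i F.< q j)
    × ((i j : Fin k) → (lookup σ (q i) < lookup σ (q j) → lookup ρ i < lookup ρ j)
                     × (lookup ρ i < lookup ρ j → lookup σ (q i) < lookup σ (q j)))
    × ((i j : Fin k) → (lookup σ (q i) ≡ lookup σ (q j) → lookup ρ i ≡ lookup ρ j)
                     × (lookup ρ i ≡ lookup ρ j → lookup σ (q i) ≡ lookup σ (q j)))

SubsetOfZeros : {n : ℕ} → Vec ℕ n → Subset n → Set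
SubsetOfZeros {n} σ Z = (i : Fin n) → i ∈ Z → lookup σ i ≡ 0

χpos : ℕ → ℕ
χpos zero = 0
χpos (suc _) = 1

χbool : Bool → ℕ
χbool true = 1
χbool false = 0

child : {n : ℕ} → Vec ℕ n → Subset n → Vec ℕ (suc n)
child {n} σ Z = 0 ∷ tabulate (λ i → lookup σ i + χpos (lookup σ i) + χbool (lookup Z i))

count0 : {k : ℕ} → Vec ℕ k → ℕ
count0 Data.Vec.[] = 0
count0 (zero ∷ ρ) = suc (count0 ρ)
count0 (suc _ ∷ ρ) = count0 ρ

BeginsWith00 : {k : ℕ} → Vec ℕ k → Set
BeginsWith00 (zero ∷ zero ∷ _) = ⊤
BeginsWith00 _ = ⊥

ZeroCondition : {k : ℕ} → Vec ℕ k → Set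
ZeroCondition ρ = (count0 ρ ≡ 1) ⊎ ((count0 ρ ≡ 2) × BeginsWith00 ρ)

{-# OPTIONS --safe #-}
-- Passing to a child maps every nonzero entry v to v + 1 and every zero to 0 or 1,
-- according to membership in Z. If the zeros of an occurrence of ρ in σ are all in Z or all
-- outside Z, this map is strictly increasing on the occurrence, so the same positions
-- (shifted by one) form an occurrence in the child. Otherwise the occurrence has two zeros,
-- so ρ has two 0s, which by hypothesis are its first two entries: match the first with the
-- new leading 0 of the child and the second with a zero of σ outside Z, which stays 0.
module Submission where

open import Defs
open import Data.Bool using (Bool; true; false)
import Data.Bool.Properties as Bool
open import Data.Empty using (⊥-elim)
open import Data.Fin using (Fin; toℕ)
import Data.Fin as F
open import Data.Fin.Properties using (any?)
open import Data.Fin.Subset using (Subset)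
open import Data.Nat using (ℕ; zero; suc; _+_; _<_; _≤_; z≤n; s≤s)
open import Data.Nat.Properties
  using (_≟_; <-cmp; <-asym; <-irrefl; <⇒≢; ≤-trans; n≮0; +-identityʳ; +-comm; suc-injective)
open import Data.Product using (_×_; ∃; ∃₂; _,_; proj₁; proj₂)
open import Data.Sum using (_⊎_; inj₁; inj₂)
open import Data.Vec using (Vec; _∷_; lookup)
open import Data.Vec.Properties using (lookup⇒[]=; lookup∘tabulate)
open import Function using (_∘_)
open import Relation.Binary using (tri<; tri≈; tri>)
open import Relation.Binary.PropositionalEquality
  using (_≡_; _≢_; refl; sym; trans; cong; cong₂; subst; subst₂; module ≡-Reasoning)
open import Relation.Nullary using (yes; no)
open import Relation.Nullary.Decidable using (_×-dec_)
open import Relation.Unary using (Pred; Decidable)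
open import Level using (Level)

StrictlyIncreasing : {k n : ℕ} → (Fin k → Fin n) → Set
StrictlyIncreasing {k} q = (i j : Fin k) → i F.< j → q i F.< q j

SameOrder : {k : ℕ} → (Fin k → ℕ) → (Fin k → ℕ) → Set
SameOrder {k} s r =
  ((i j : Fin k) → (s i < s j → r i < r j) × (r i < r j → s i < s j))
  × ((i j : Fin k) → (s i ≡ s j → r i ≡ r j) × (r i ≡ r j → s i ≡ s j))

sameOrder-sym : {k : ℕ} {s r : Fin k → ℕ} → SameOrder s r → SameOrder r s
sameOrder-sym (lt , eq) =
  (λ i j → proj₂ (lt i j) , proj₁ (lt i j)) , (λ i j → proj₂ (eq i j) , proj₁ (eq i j))

sameOrder-zero : {k : ℕ} {s r : Fin k → ℕ} → SameOrder s r →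
  (l : Fin k) → r l ≡ 0 → (i : Fin k) → s i ≡ 0 → r i ≡ 0
sameOrder-zero {s = s} {r} (lt , _) l rl≡0 i si≡0 with r i in ri≡
... | zero = refl
... | suc _ = ⊥-elim (n≮0 (subst (s l <_) si≡0
                (proj₂ (lt l i) (subst₂ _<_ (sym rl≡0) (sym ri≡) (s≤s z≤n)))))

module _ {f : ℕ → ℕ} (f-mono : ∀ {a b} → a < b → f a < f b) where

  strictMono-reflects-< : ∀ {a b} → f a < f b → a < b
  strictMono-reflects-< {a} {b} fa<fb with <-cmp a b
  ... | tri< a<b _ _ = a<b
  ... | tri≈ _ refl _ = ⊥-elim (<-irrefl refl fa<fb)
  ... | tri> _ _ b<a = ⊥-elim (<-asym fa<fb (f-mono b<a))

  strictMono-injective : ∀ {a b} → f a ≡ f b → a ≡ b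
  strictMono-injective {a} {b} fa≡fb with <-cmp a b
  ... | tri< a<b _ _ = ⊥-elim (<⇒≢ (f-mono a<b) fa≡fb)
  ... | tri≈ _ a≡b _ = a≡b
  ... | tri> _ _ b<a = ⊥-elim (<⇒≢ (f-mono b<a) (sym fa≡fb))

  sameOrder-strictMono : {k : ℕ} {s t r : Fin k → ℕ} →
    (∀ i → t i ≡ f (s i)) → SameOrder s r → SameOrder t r
  sameOrder-strictMono {s = s} {t} t≡fs (lt , eq) =
    (λ i j → (λ ti<tj → proj₁ (lt i j) (strictMono-reflects-< (subst₂ _<_ (t≡fs i) (t≡fs j) ti<tj)))
           , (λ ri<rj → subst₂ _<_ (sym (t≡fs i)) (sym (t≡fs j)) (f-mono (proj₂ (lt i j) ri<rj))))
    , (λ i j → (λ ti≡tj → proj₁ (eq i j) (strictMono-injective (trans (sym (t≡fs i)) (trans ti≡tj (t≡fs j)))))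
             , (λ ri≡rj → trans (t≡fs i) (trans (cong f (proj₂ (eq i j) ri≡rj)) (sym (t≡fs j)))))

bump : ℕ → ℕ → ℕ
bump c zero = c
bump c (suc v) = suc (suc v)

bump-strictMono : ∀ {c a b} → c ≤ 1 → a < b → bump c a < bump c b
bump-strictMono {a = zero} {suc _} c≤1 _ = s≤s (≤-trans c≤1 (s≤s z≤n))
bump-strictMono {a = suc _} {suc _} _ a<b = s≤s a<b

bump-agree : ∀ {c c′ v} → (v ≡ 0 → c ≡ c′) → bump c v ≡ bump c′ v
bump-agree {v = zero} c≡c′ = c≡c′ refl
bump-agree {v = suc _} _ = refl

χbool≤1 : (b : Bool) → χbool b ≤ 1
χbool≤1 true = s≤s z≤n
χbool≤1 false = z≤n

lookup≡0⇒0<count0 : {k : ℕ} (v : Vec ℕ k) (i : Fin k) → lookup v i ≡ 0 → 0 < count0 v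
lookup≡0⇒0<count0 (zero ∷ v) _ _ = s≤s z≤n
lookup≡0⇒0<count0 (suc _ ∷ v) (F.suc i) vi≡0 = lookup≡0⇒0<count0 v i vi≡0

distinct-lookup≡0⇒1<count0 : {k : ℕ} (v : Vec ℕ k) (i j : Fin k) → i ≢ j →
  lookup v i ≡ 0 → lookup v j ≡ 0 → 1 < count0 v
distinct-lookup≡0⇒1<count0 (x ∷ v) F.zero F.zero i≢j _ _ = ⊥-elim (i≢j refl)
distinct-lookup≡0⇒1<count0 (zero ∷ v) F.zero (F.suc j) _ _ vj≡0 = s≤s (lookup≡0⇒0<count0 v j vj≡0)
distinct-lookup≡0⇒1<count0 (zero ∷ v) (F.suc i) _ _ vi≡0 _ = s≤s (lookup≡0⇒0<count0 v i vi≡0)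
distinct-lookup≡0⇒1<count0 (suc _ ∷ v) (F.suc i) (F.suc j) i≢j vi≡0 vj≡0 =
  distinct-lookup≡0⇒1<count0 v i j (i≢j ∘ cong F.suc) vi≡0 vj≡0

constant-or-split : {k : ℕ} {p : Level} {P : Pred (Fin k) p} → Decidable P → (b : Fin k → Bool) →
  (∃ λ β → ∀ i → P i → b i ≡ β) ⊎ (∃₂ λ i j → (P i × b i ≡ true) × (P j × b j ≡ false))
constant-or-split P? b with any? (λ i → P? i ×-dec (b i Bool.≟ true))
... | no ¬true = inj₁ (false , λ i Pi → Bool.¬-not (λ bi → ¬true (i , Pi , bi)))
... | yes (i , hi) with any? (λ j → P? j ×-dec (b j Bool.≟ false))
...   | no ¬false = inj₁ (true , λ j Pj → Bool.¬-not (λ bj → ¬false (j , Pj , bj)))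
...   | yes (j , hj) = inj₂ (i , j , hi , hj)

module _ {n : ℕ} (σ : Vec ℕ n) {Z : Subset n} (Z⊆0 : SubsetOfZeros σ Z) where

  open ≡-Reasoning

  lookup-child-suc : (x : Fin n) → lookup (child σ Z) (F.suc x) ≡ bump (χbool (lookup Z x)) (lookup σ x)
  lookup-child-suc x =
    trans (lookup∘tabulate _ x) (entry (lookup σ x) (lookup Z x) (Z⊆0 x ∘ lookup⇒[]= x Z))
    where
    entry : ∀ v b → (b ≡ true → v ≡ 0) → v + χpos v + χbool b ≡ bump (χbool b) v
    entry zero b _ = refl
    entry (suc v) false _ = cong suc (trans (+-identityʳ _) (+-comm v 1))
    entry (suc v) true v≡0 with () ← v≡0 refl

  child-contains-shifted : {k : ℕ} (ρ : Vec ℕ k) {q : Fin k → Fin n} →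
    StrictlyIncreasing q → SameOrder (lookup σ ∘ q) (lookup ρ) →
    (β : Bool) → (∀ i → lookup σ (q i) ≡ 0 → lookup Z (q i) ≡ β) → Contains (child σ Z) ρ
  child-contains-shifted _ {q} q-inc σq≈ρ β constant =
    F.suc ∘ q , (λ i j i<j → s≤s (q-inc i j i<j)) ,
    sameOrder-strictMono (bump-strictMono (χbool≤1 β)) shifted σq≈ρ
    where
    shifted : ∀ i → lookup (child σ Z) (F.suc (q i)) ≡ bump (χbool β) (lookup σ (q i))
    shifted i = trans (lookup-child-suc (q i)) (bump-agree (cong χbool ∘ constant i))

  child-contains-00 : {k : ℕ} (ρ : Vec ℕ k) → BeginsWith00 ρ → count0 ρ ≡ 2 →
    {q : Fin k → Fin n} → StrictlyIncreasing q → SameOrder (lookup σ ∘ q) (lookup ρ) →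
    (j : Fin k) → lookup σ (q j) ≡ 0 → lookup Z (q j) ≡ false → Contains (child σ Z) ρ
  child-contains-00 (zero ∷ zero ∷ ρ′) _ count≡2 {q} q-inc σq≈ρ j σqj≡0 Zqj≡false =
    q′ , q′-inc , sameOrder-strictMono (bump-strictMono z≤n) τq′≡ σq≈ρ
    where
    ρ′-nonzero : ∀ l → lookup ρ′ l ≢ 0
    ρ′-nonzero l ρ′l≡0
      with () ← subst (0 <_) (suc-injective (suc-injective count≡2)) (lookup≡0⇒0<count0 ρ′ l ρ′l≡0)

    σq≡0⇒ρ≡0 : ∀ i → lookup σ (q i) ≡ 0 → lookup (zero ∷ zero ∷ ρ′) i ≡ 0
    σq≡0⇒ρ≡0 = sameOrder-zero σq≈ρ F.zero refl

    ρ≡0⇒σq≡0 : ∀ i → lookup (zero ∷ zero ∷ ρ′) i ≡ 0 → lookup σ (q i) ≡ 0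
    ρ≡0⇒σq≡0 = sameOrder-zero (sameOrder-sym σq≈ρ) j σqj≡0

    σq≡0⇒index≤1 : ∀ i → lookup σ (q i) ≡ 0 → toℕ i ≤ 1
    σq≡0⇒index≤1 F.zero _ = z≤n
    σq≡0⇒index≤1 (F.suc F.zero) _ = s≤s z≤n
    σq≡0⇒index≤1 (F.suc (F.suc l)) σq≡0 = ⊥-elim (ρ′-nonzero l (σq≡0⇒ρ≡0 _ σq≡0))

    q′ : Fin (suc (suc _)) → Fin (suc n)
    q′ F.zero = F.zero
    q′ (F.suc F.zero) = F.suc (q j)
    q′ (F.suc (F.suc l)) = F.suc (q (F.suc (F.suc l)))

    q′-inc : StrictlyIncreasing q′
    q′-inc F.zero (F.suc F.zero) _ = s≤s z≤n
    q′-inc F.zero (F.suc (F.suc _)) _ = s≤s z≤n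
    q′-inc (F.suc F.zero) (F.suc (F.suc l)) _ =
      s≤s (q-inc j _ (s≤s (≤-trans (σq≡0⇒index≤1 j σqj≡0) (s≤s z≤n))))
    q′-inc (F.suc (F.suc a)) (F.suc (F.suc b)) a<b = s≤s (q-inc _ _ a<b)
    q′-inc (F.suc F.zero) (F.suc F.zero) (s≤s ())
    q′-inc (F.suc (F.suc _)) (F.suc F.zero) (s≤s ())

    τq′≡ : ∀ i → lookup (child σ Z) (q′ i) ≡ bump 0 (lookup σ (q i))
    τq′≡ F.zero = sym (cong (bump 0) (ρ≡0⇒σq≡0 F.zero refl))
    τq′≡ (F.suc F.zero) = begin
      lookup (child σ Z) (F.suc (q j))               ≡⟨ lookup-child-suc (q j) ⟩
      bump (χbool (lookup Z (q j))) (lookup σ (q j)) ≡⟨ cong₂ bump (cong χbool Zqj≡false) σqj≡0 ⟩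
      0                                              ≡⟨ sym (cong (bump 0) (ρ≡0⇒σq≡0 (F.suc F.zero) refl)) ⟩
      bump 0 (lookup σ (q (F.suc F.zero)))           ∎
    τq′≡ (F.suc (F.suc l)) = trans (lookup-child-suc (q _))
      (bump-agree (λ σq≡0 → ⊥-elim (ρ′-nonzero l (σq≡0⇒ρ≡0 _ σq≡0))))

proposition2p1 : {k n : ℕ} (ρ : Vec ℕ k) (σ : Vec ℕ n) (Z : Subset n) →
    IsPattern ρ → ZeroCondition ρ →
    IsInversionSequence σ → Contains σ ρ →
    SubsetOfZeros σ Z →
    Contains (child σ Z) ρ
proposition2p1 ρ σ Z (_ , _ , _ , onto) zc _ (q , q-inc , σq≈ρ) Z⊆0
  with constant-or-split (λ i → lookup σ (q i) ≟ 0) (lookup Z ∘ q)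
... | inj₁ (β , constant) = child-contains-shifted σ Z⊆0 ρ q-inc σq≈ρ β constant
... | inj₂ (i , j , (σqi≡0 , Zqi≡true) , (σqj≡0 , Zqj≡false)) with zc
...   | inj₂ (count≡2 , begins00) = child-contains-00 σ Z⊆0 ρ begins00 count≡2 q-inc σq≈ρ j σqj≡0 Zqj≡false
...   | inj₁ count≡1 = ⊥-elim (<-irrefl (sym count≡1) two-zeros)
  where
  σq≡0⇒ρ≡0 : ∀ i → lookup σ (q i) ≡ 0 → lookup ρ i ≡ 0
  σq≡0⇒ρ≡0 = sameOrder-zero σq≈ρ (proj₁ (onto 0 z≤n)) (proj₂ (onto 0 z≤n))

  i≢j : i ≢ j
  i≢j refl with () ← trans (sym Zqi≡true) Zqj≡false

  two-zeros : 1 < count0 ρ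
  two-zeros = distinct-lookup≡0⇒1<count0 ρ i j i≢j (σq≡0⇒ρ≡0 i σqi≡0) (σq≡0⇒ρ≡0 j σqj≡0)
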